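{- For every standard Pythagorean triple $(a,b,c)$ there exist polynomials $\mathcal{A}(q),\mathcal{B}(q),\mathcal{C}(q)$ in one variable $q$ such that: (0) they satisfy the $q$-deformed Pythagoras equation $$\mathcal{A}(q)^2+q\,\mathcal{B}(q)^2=\mathcal{C}(q)\,\mathcal{C}^*(q),$$ where $\mathcal{C}^*(q):=q^{\deg(\mathcal{C})}\mathcal{C}(q^{ -1})$ is the polynomial reciprocal to $\mathcal{C}$; (1) the polynomials $\mathcal{A},\mathcal{B},\mathcal{C}$ have positive integer coefficients; (2) the polynomials $\mathcal{A}$ and $\mathcal{B}$ are self-reciprocal (palindromic), i.e. $q^{\deg \mathcal{A}}\mathcal{A}(q^{ -1})=\mathcal{A}(q)$ and $q^{\deg \mathcal{B}}\mathcal{B}(q^{ -1})=\mathcal{B}(q)$; (3) the polynomials $\mathcal{A},\mathcal{B},\mathcal{C}$ and $\mathcal{C}^*$ are monic in the sense that their leading coefficient and their lowest-degree coefficient are both equal to $1$; and moreover $(\mathcal{A}(1),\mathcal{B}(1),\mathcal{C}(1))=(a,b,c)$.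
   Context: A Pythagorean triple is a triple $(a,b,c)$ of positive integers with $a^2+b^2=c^2$. A Pythagorean triple is called standard if either $\gcd(a,b,c)=1$ and $a$ is even, or $\gcd(a,b,c)=2$ and $a/2$ is odd. -}

module Defs where

open import Data.Nat using (ℕ; zero; suc; _+_; _*_; _∸_; _^_; _/_; _≥_)
open import Data.Nat.Divisibility using (_∣_)
open import Data.Nat.GCD using (gcd)
open import Data.List using (List; []; _∷_; map; reverse; length)
open import Data.Nat.ListAction using (sum)
open import Data.List.Relation.Unary.All using (All)
open import Data.Product using (_×_)
open import Data.Sum using (_⊎_)
open import Relation.Nullary using (¬_)
open import Relation.Binary.PropositionalEquality using (_≡_)

Even : ℕ → Set
Even n = 2 ∣ n

Odd : ℕ → Set
Odd n = ¬ (2 ∣ n)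

PythagoreanTriple : ℕ → ℕ → ℕ → Set
PythagoreanTriple a b c =
  (a ≥ 1) × (b ≥ 1) × (c ≥ 1) × (a * a + b * b ≡ c * c)

Standard : ℕ → ℕ → ℕ → Set
Standard a b c =
  PythagoreanTriple a b c ×
  ((gcd (gcd a b) c ≡ 1 × Even a) ⊎ (gcd (gcd a b) c ≡ 2 × Odd (a / 2)))

-- Polynomials in one variable q with natural-number coefficients,
-- represented by coefficient lists, constant term first:
-- [p₀, p₁, …, p_d] stands for p₀ + p₁ q + … + p_d q^d.
Poly : Set
Poly = List ℕ

coeff : Poly → ℕ → ℕ
coeff []       _       = 0
coeff (x ∷ _)  zero    = x
coeff (_ ∷ xs) (suc i) = coeff xs i

_≈ₚ_ : Poly → Poly → Set
p ≈ₚ r = ∀ i → coeff p i ≡ coeff r i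

infix 4 _≈ₚ_
infixl 6 _+ₚ_
infixl 7 _*ₚ_

_+ₚ_ : Poly → Poly → Poly
[]       +ₚ r        = r
(x ∷ xs) +ₚ []       = x ∷ xs
(x ∷ xs) +ₚ (y ∷ ys) = (x + y) ∷ (xs +ₚ ys)

_*ₚ_ : Poly → Poly → Poly
[]       *ₚ r = []
(x ∷ xs) *ₚ r = map (x *_) r +ₚ (0 ∷ (xs *ₚ r))

qₚ* : Poly → Poly
qₚ* p = 0 ∷ p

eval1 : Poly → ℕ
eval1 p = sum p

-- All coefficients c₀,…,c_d of the polynomial (d = length p ∸ 1) are
-- positive integers.  For such a list the last entry is nonzero, so the
-- degree is exactly length p ∸ 1.
PositiveCoeffs : Poly → Set
PositiveCoeffs p = All (λ x → x ≥ 1) p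

-- degree (correct for lists whose last entry is nonzero, e.g. PositiveCoeffs)
deg : Poly → ℕ
deg p = length p ∸ 1

-- reciprocal polynomial q^{deg p} p(q⁻¹): reverse the coefficient list
-- (correct as the reciprocal when the last entry is nonzero)
reciprocal : Poly → Poly
reciprocal p = reverse p

leadingCoeff : Poly → ℕ
leadingCoeff p = coeff p (deg p)

-- lowest-degree coefficient (for PositiveCoeffs this is the constant term,
-- the lowest-degree nonzero coefficient)
lowestCoeff : Poly → ℕ
lowestCoeff p = coeff p 0

SelfReciprocal : Poly → Set
SelfReciprocal p = reciprocal p ≈ₚ p

Monic : Poly → Set
Monic p = (leadingCoeff p ≡ 1) × (lowestCoeff p ≡ 1)

{-# OPTIONS --safe #-}
module Submission where

-- A standard triple is (2mn, m² − n², m² + n²) with m = n + k and n, k ≥ 1: writing a = 2Z and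
-- c = b + 2Y, the equation becomes (b + Y) Y = Z² with coprime factors, so both are squares.
-- Replacing each integer j by its q-analogue [j] = 1 + q + ⋯ + q^(j−1), put
--   A = (1 + q^(k+1)) [m][n],   B = [k][m+n],   C = [m]² + q^(2k+1) [n]²,
-- whose reciprocal is C* = q[m]² + [n]².  The q-analogue [m]² = B + q^k [n]² of
-- m² = (m² − n²) + n² turns A² + qB² = C C* into a polynomial identity in B, [n], q and q^k.
-- Reciprocals are computed by reflecting at a degree bound, which is multiplicative, so products
-- of the palindromic [j] are palindromic; this makes A and B self-reciprocal and fixes the
-- leading coefficients.

open import Algebra.Bundles using (CommutativeSemiring)
open import Algebra.Structures.Biased using (isCommutativeMonoidˡ; isCommutativeSemiringˡ)
open import Data.List using ([]; _∷_; map; reverse; length; _∷ʳ_)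
open import Data.List.Properties using (unfold-reverse; length-reverse)
open import Data.List.Relation.Unary.All using ([]; _∷_)
open import Data.Nat using (ℕ; zero; suc; _+_; _*_; _∸_; _/_; _≤_; _<_; z≤n; s≤s; _≤?_; NonZero; ≢-nonZero)
open import Data.Nat.Coprimality using (Coprime; coprime-divisor; 1-coprimeTo) renaming (sym to coprime-sym)
open import Data.Nat.Divisibility
  using (_∣_; divides; quotient; ∣-trans; ∣-antisym; m∣n⇒n≡m*quotient; n∣m*n; m∣m*n; n∣m*n*o; ∣m⇒∣m*n;
         ∣m+n∣m⇒∣n; ∣m∣n⇒∣m+n; *-pres-∣; *-monoʳ-∣; *-cancelˡ-∣)
open import Data.Nat.DivMod using (m*n/n≡m)
open import Data.Nat.GCD using (gcd; gcd[m,n]∣m; gcd[m,n]∣n; gcd[m,n]≢0; gcd-greatest; c*gcd[m,n]≡gcd[cm,cn])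
open import Data.Nat.ListAction using (sum)
open import Data.Nat.Primality using (prime[2]; irreducible[2]; euclidsLemma)
open import Data.Nat.Properties
open import Data.Nat.Tactic.RingSolver using (solve-∀)
open import Data.Product using (Σ; ∃; ∃₂; _×_; _,_; proj₁; proj₂)
open import Data.Sum using (_⊎_; inj₁; inj₂; [_,_]′)
open import Defs
open import Function using (id)
open import Level using (0ℓ)
open import Relation.Binary.Bundles using (Setoid)
open import Relation.Binary.PropositionalEquality
open import Relation.Binary.Structures using (IsEquivalence)
open import Relation.Nullary using (yes; no; contradiction)
import Relation.Binary.Reasoning.Setoid as SetoidReasoning
open import Algebra.Properties.CommutativeSemigroup +-commutativeSemigroup using () renaming (interchange to +-interchange)

-- Polynomials up to coefficientwise equality form a commutative semiring

infixl 7 _·ₚ_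
_·ₚ_ : ℕ → Poly → Poly
x ·ₚ p = map (x *_) p

infix 4 _≋_
-- A record rather than p ≈ₚ r itself, whose Π-type does not determine p and r for inference
-- (likewise for Deg≤ below).
record _≋_ (p r : Poly) : Set where
  constructor mk≋
  field coeff-≡ : p ≈ₚ r
open _≋_ public

coeff-+ₚ : ∀ p r i → coeff (p +ₚ r) i ≡ coeff p i + coeff r i
coeff-+ₚ []       r        i       = refl
coeff-+ₚ (x ∷ xs) []       zero    = sym (+-identityʳ x)
coeff-+ₚ (x ∷ xs) []       (suc i) = sym (+-identityʳ _)
coeff-+ₚ (x ∷ xs) (y ∷ ys) zero    = refl
coeff-+ₚ (x ∷ xs) (y ∷ ys) (suc i) = coeff-+ₚ xs ys i

coeff-·ₚ : ∀ x p i → coeff (x ·ₚ p) i ≡ x * coeff p i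
coeff-·ₚ x []       i       = sym (*-zeroʳ x)
coeff-·ₚ x (y ∷ ys) zero    = refl
coeff-·ₚ x (y ∷ ys) (suc i) = coeff-·ₚ x ys i

≋-refl : ∀ {p} → p ≋ p
≋-refl = mk≋ λ _ → refl

≋-reflexive : ∀ {p r} → p ≡ r → p ≋ r
≋-reflexive refl = ≋-refl

≋-sym : ∀ {p r} → p ≋ r → r ≋ p
≋-sym (mk≋ eq) = mk≋ λ i → sym (eq i)

≋-trans : ∀ {p r s} → p ≋ r → r ≋ s → p ≋ s
≋-trans (mk≋ eq) (mk≋ eq′) = mk≋ λ i → trans (eq i) (eq′ i)

≋-isEquivalence : IsEquivalence _≋_
≋-isEquivalence = record { refl = ≋-refl ; sym = ≋-sym ; trans = ≋-trans }

≋-setoid : Setoid 0ℓ 0ℓ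
≋-setoid = record { isEquivalence = ≋-isEquivalence }

module ≋-Reasoning = SetoidReasoning ≋-setoid

∷-cong : ∀ {x y xs ys} → x ≡ y → xs ≋ ys → x ∷ xs ≋ y ∷ ys
∷-cong x≡y (mk≋ eq) = mk≋ λ { zero → x≡y ; (suc i) → eq i }

∷-injectiveʳ : ∀ {x y xs ys} → x ∷ xs ≋ y ∷ ys → xs ≋ ys
∷-injectiveʳ (mk≋ eq) = mk≋ λ i → eq (suc i)

0∷-≋[] : ∀ {p} → p ≋ [] → 0 ∷ p ≋ []
0∷-≋[] (mk≋ eq) = mk≋ λ { zero → refl ; (suc i) → eq i }

+ₚ-cong : ∀ {p p′ r r′} → p ≋ p′ → r ≋ r′ → p +ₚ r ≋ p′ +ₚ r′
+ₚ-cong {p} {p′} {r} {r′} (mk≋ eq) (mk≋ eq′) = mk≋ λ i → begin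
  coeff (p +ₚ r) i        ≡⟨ coeff-+ₚ p r i ⟩
  coeff p i + coeff r i   ≡⟨ cong₂ _+_ (eq i) (eq′ i) ⟩
  coeff p′ i + coeff r′ i ≡⟨ coeff-+ₚ p′ r′ i ⟨
  coeff (p′ +ₚ r′) i      ∎
  where open ≡-Reasoning

+ₚ-congˡ : ∀ r {p p′} → p ≋ p′ → p +ₚ r ≋ p′ +ₚ r
+ₚ-congˡ r eq = +ₚ-cong eq ≋-refl

+ₚ-congʳ : ∀ p {r r′} → r ≋ r′ → p +ₚ r ≋ p +ₚ r′
+ₚ-congʳ p eq = +ₚ-cong ≋-refl eq

·ₚ-congʳ : ∀ x {p r} → p ≋ r → x ·ₚ p ≋ x ·ₚ r
·ₚ-congʳ x {p} {r} (mk≋ eq) = mk≋ λ i → begin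
  coeff (x ·ₚ p) i ≡⟨ coeff-·ₚ x p i ⟩
  x * coeff p i    ≡⟨ cong (x *_) (eq i) ⟩
  x * coeff r i    ≡⟨ coeff-·ₚ x r i ⟨
  coeff (x ·ₚ r) i ∎
  where open ≡-Reasoning

+ₚ-identityʳ : ∀ p → p +ₚ [] ≡ p
+ₚ-identityʳ []      = refl
+ₚ-identityʳ (_ ∷ _) = refl

+ₚ-comm : ∀ p r → p +ₚ r ≡ r +ₚ p
+ₚ-comm []       []       = refl
+ₚ-comm []       (_ ∷ _)  = refl
+ₚ-comm (_ ∷ _)  []       = refl
+ₚ-comm (x ∷ xs) (y ∷ ys) = cong₂ _∷_ (+-comm x y) (+ₚ-comm xs ys)

+ₚ-assoc : ∀ p r s → (p +ₚ r) +ₚ s ≡ p +ₚ (r +ₚ s)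
+ₚ-assoc []       _        _        = refl
+ₚ-assoc (_ ∷ _)  []       _        = refl
+ₚ-assoc (_ ∷ _)  (_ ∷ _)  []       = refl
+ₚ-assoc (x ∷ xs) (y ∷ ys) (z ∷ zs) = cong₂ _∷_ (+-assoc x y z) (+ₚ-assoc xs ys zs)

·ₚ-distribˡ-+ₚ : ∀ x p r → x ·ₚ (p +ₚ r) ≡ x ·ₚ p +ₚ x ·ₚ r
·ₚ-distribˡ-+ₚ x []       _        = refl
·ₚ-distribˡ-+ₚ x (_ ∷ _)  []       = refl
·ₚ-distribˡ-+ₚ x (y ∷ ys) (z ∷ zs) = cong₂ _∷_ (*-distribˡ-+ x y z) (·ₚ-distribˡ-+ₚ x ys zs)

·ₚ-distribʳ-+ : ∀ x y p → (x + y) ·ₚ p ≡ x ·ₚ p +ₚ y ·ₚ p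
·ₚ-distribʳ-+ x y []       = refl
·ₚ-distribʳ-+ x y (z ∷ zs) = cong₂ _∷_ (*-distribʳ-+ z x y) (·ₚ-distribʳ-+ x y zs)

·ₚ-assoc : ∀ x y p → x ·ₚ (y ·ₚ p) ≡ (x * y) ·ₚ p
·ₚ-assoc x y []       = refl
·ₚ-assoc x y (z ∷ zs) = cong₂ _∷_ (sym (*-assoc x y z)) (·ₚ-assoc x y zs)

·ₚ-identityˡ : ∀ p → 1 ·ₚ p ≡ p
·ₚ-identityˡ []       = refl
·ₚ-identityˡ (x ∷ xs) = cong₂ _∷_ (+-identityʳ x) (·ₚ-identityˡ xs)

·ₚ-zeroˡ : ∀ p → 0 ·ₚ p ≋ []
·ₚ-zeroˡ p = mk≋ (coeff-·ₚ 0 p)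

+ₚ-interchange : ∀ p r s t → (p +ₚ r) +ₚ (s +ₚ t) ≡ (p +ₚ s) +ₚ (r +ₚ t)
+ₚ-interchange p r s t = begin
  (p +ₚ r) +ₚ (s +ₚ t) ≡⟨ +ₚ-assoc p r (s +ₚ t) ⟩
  p +ₚ (r +ₚ (s +ₚ t)) ≡⟨ cong (p +ₚ_) (+ₚ-assoc r s t) ⟨
  p +ₚ ((r +ₚ s) +ₚ t) ≡⟨ cong (λ u → p +ₚ (u +ₚ t)) (+ₚ-comm r s) ⟩
  p +ₚ ((s +ₚ r) +ₚ t) ≡⟨ cong (p +ₚ_) (+ₚ-assoc s r t) ⟩
  p +ₚ (s +ₚ (r +ₚ t)) ≡⟨ +ₚ-assoc p s (r +ₚ t) ⟨
  (p +ₚ s) +ₚ (r +ₚ t) ∎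
  where open ≡-Reasoning

1ₚ : Poly
1ₚ = 1 ∷ []

*ₚ-zeroʳ : ∀ p → p *ₚ [] ≋ []
*ₚ-zeroʳ []       = ≋-refl
*ₚ-zeroʳ (_ ∷ xs) = 0∷-≋[] (*ₚ-zeroʳ xs)

≋[]⇒*ₚ≋[] : ∀ {p} r → p ≋ [] → p *ₚ r ≋ []
≋[]⇒*ₚ≋[] {[]}     r _        = ≋-refl
≋[]⇒*ₚ≋[] {x ∷ xs} r (mk≋ eq) = +ₚ-cong x·r≋[] (0∷-≋[] (≋[]⇒*ₚ≋[] {xs} r (mk≋ λ i → eq (suc i))))
  where
  x·r≋[] : x ·ₚ r ≋ []
  x·r≋[] = ≋-trans (≋-reflexive (cong (_·ₚ r) (eq zero))) (·ₚ-zeroˡ r)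

*ₚ-congˡ : ∀ r {p p′} → p ≋ p′ → p *ₚ r ≋ p′ *ₚ r
*ₚ-congˡ r {[]}     {[]}     _  = ≋-refl
*ₚ-congˡ r {[]}     {_ ∷ _}  eq = ≋-sym (≋[]⇒*ₚ≋[] r (≋-sym eq))
*ₚ-congˡ r {_ ∷ _}  {[]}     eq = ≋[]⇒*ₚ≋[] r eq
*ₚ-congˡ r {x ∷ xs} {y ∷ ys} eq =
  +ₚ-cong (≋-reflexive (cong (_·ₚ r) (coeff-≡ eq zero))) (∷-cong refl (*ₚ-congˡ r (∷-injectiveʳ eq)))

*ₚ-congʳ : ∀ p {r r′} → r ≋ r′ → p *ₚ r ≋ p *ₚ r′
*ₚ-congʳ []       _  = ≋-refl
*ₚ-congʳ (x ∷ xs) eq = +ₚ-cong (·ₚ-congʳ x eq) (∷-cong refl (*ₚ-congʳ xs eq))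

*ₚ-cong : ∀ {p p′ r r′} → p ≋ p′ → r ≋ r′ → p *ₚ r ≋ p′ *ₚ r′
*ₚ-cong {p} {p′} {r} p≋p′ r≋r′ = ≋-trans (*ₚ-congˡ r p≋p′) (*ₚ-congʳ p′ r≋r′)

*ₚ-distribʳ-+ₚ : ∀ r p p′ → (p +ₚ p′) *ₚ r ≋ p *ₚ r +ₚ p′ *ₚ r
*ₚ-distribʳ-+ₚ r []       _        = ≋-refl
*ₚ-distribʳ-+ₚ r (x ∷ xs) []       = ≋-reflexive (sym (+ₚ-identityʳ _))
*ₚ-distribʳ-+ₚ r (x ∷ xs) (y ∷ ys) = ≋-trans
  (+ₚ-cong (≋-reflexive (·ₚ-distribʳ-+ x y r)) (∷-cong refl (*ₚ-distribʳ-+ₚ r xs ys)))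
  (≋-reflexive (+ₚ-interchange (x ·ₚ r) (y ·ₚ r) (0 ∷ xs *ₚ r) (0 ∷ ys *ₚ r)))

0∷-*ₚ : ∀ p r → (0 ∷ p) *ₚ r ≋ 0 ∷ p *ₚ r
0∷-*ₚ p r = +ₚ-cong (·ₚ-zeroˡ r) ≋-refl

·ₚ-*ₚ : ∀ x p r → (x ·ₚ p) *ₚ r ≋ x ·ₚ (p *ₚ r)
·ₚ-*ₚ x []       r = ≋-refl
·ₚ-*ₚ x (y ∷ ys) r = ≋-trans (+ₚ-cong ≋-refl (∷-cong (sym (*-zeroʳ x)) (·ₚ-*ₚ x ys r))) (≋-reflexive (begin
  (x * y) ·ₚ r +ₚ x ·ₚ (0 ∷ ys *ₚ r)   ≡⟨ cong (_+ₚ x ·ₚ (0 ∷ ys *ₚ r)) (·ₚ-assoc x y r) ⟨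
  x ·ₚ (y ·ₚ r) +ₚ x ·ₚ (0 ∷ ys *ₚ r) ≡⟨ ·ₚ-distribˡ-+ₚ x (y ·ₚ r) (0 ∷ ys *ₚ r) ⟨
  x ·ₚ (y ·ₚ r +ₚ (0 ∷ ys *ₚ r))      ∎))
  where open ≡-Reasoning

*ₚ-assoc : ∀ p r s → (p *ₚ r) *ₚ s ≋ p *ₚ (r *ₚ s)
*ₚ-assoc []       r s = ≋-refl
*ₚ-assoc (x ∷ xs) r s = ≋-trans (*ₚ-distribʳ-+ₚ s (x ·ₚ r) (0 ∷ xs *ₚ r))
  (+ₚ-cong (·ₚ-*ₚ x r s) (≋-trans (0∷-*ₚ (xs *ₚ r) s) (∷-cong refl (*ₚ-assoc xs r s))))

*ₚ-∷ʳ : ∀ p y ys → p *ₚ (y ∷ ys) ≋ y ·ₚ p +ₚ (0 ∷ p *ₚ ys)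
*ₚ-∷ʳ []       y ys = ≋-sym (0∷-≋[] ≋-refl)
*ₚ-∷ʳ (x ∷ xs) y ys = ∷-cong (cong (_+ 0) (*-comm x y)) (≋-trans
  (+ₚ-cong ≋-refl (*ₚ-∷ʳ xs y ys))
  (≋-reflexive (begin
    x ·ₚ ys +ₚ (y ·ₚ xs +ₚ (0 ∷ xs *ₚ ys)) ≡⟨ +ₚ-assoc (x ·ₚ ys) (y ·ₚ xs) _ ⟨
    (x ·ₚ ys +ₚ y ·ₚ xs) +ₚ (0 ∷ xs *ₚ ys) ≡⟨ cong (_+ₚ (0 ∷ xs *ₚ ys)) (+ₚ-comm (x ·ₚ ys) (y ·ₚ xs)) ⟩
    (y ·ₚ xs +ₚ x ·ₚ ys) +ₚ (0 ∷ xs *ₚ ys) ≡⟨ +ₚ-assoc (y ·ₚ xs) (x ·ₚ ys) _ ⟩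
    y ·ₚ xs +ₚ (x ·ₚ ys +ₚ (0 ∷ xs *ₚ ys)) ∎)))
  where open ≡-Reasoning

*ₚ-comm : ∀ p r → p *ₚ r ≋ r *ₚ p
*ₚ-comm []       r = ≋-sym (*ₚ-zeroʳ r)
*ₚ-comm (x ∷ xs) r = ≋-trans (+ₚ-cong ≋-refl (∷-cong refl (*ₚ-comm xs r))) (≋-sym (*ₚ-∷ʳ r x xs))

*ₚ-identityˡ : ∀ p → 1ₚ *ₚ p ≋ p
*ₚ-identityˡ p = ≋-trans (+ₚ-cong (≋-reflexive (·ₚ-identityˡ p)) (0∷-≋[] ≋-refl)) (≋-reflexive (+ₚ-identityʳ p))

+ₚ-*ₚ-commutativeSemiring : CommutativeSemiring 0ℓ 0ℓ
+ₚ-*ₚ-commutativeSemiring = record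
  { _≈_ = _≋_ ; _+_ = _+ₚ_ ; _*_ = _*ₚ_ ; 0# = [] ; 1# = 1ₚ
  ; isCommutativeSemiring = isCommutativeSemiringˡ record
    { +-isCommutativeMonoid = isCommutativeMonoidˡ record
      { isSemigroup = record
        { isMagma = record { isEquivalence = ≋-isEquivalence ; ∙-cong = +ₚ-cong }
        ; assoc   = λ p r s → ≋-reflexive (+ₚ-assoc p r s) }
      ; identityˡ = λ _ → ≋-refl
      ; comm      = λ p r → ≋-reflexive (+ₚ-comm p r) }
    ; *-isCommutativeMonoid = isCommutativeMonoidˡ record
      { isSemigroup = record
        { isMagma = record { isEquivalence = ≋-isEquivalence ; ∙-cong = *ₚ-cong }
        ; assoc   = *ₚ-assoc }
      ; identityˡ = *ₚ-identityˡ
      ; comm      = *ₚ-comm }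
    ; distribʳ = *ₚ-distribʳ-+ₚ
    ; zeroˡ    = λ _ → ≋-refl } }

open import Algebra.Solver.Ring.NaturalCoefficients.Default +ₚ-*ₚ-commutativeSemiring
  using (_:+_; _:*_; _:=_; con) renaming (solve to solveₚ)

-- Used with Q = q, U = q^k, M = [m], N = [n].
q-pythagoras : ∀ {Q U B M N} → M *ₚ M ≋ B +ₚ U *ₚ (N *ₚ N) →
  ((1ₚ +ₚ Q *ₚ U) *ₚ (M *ₚ N)) *ₚ ((1ₚ +ₚ Q *ₚ U) *ₚ (M *ₚ N)) +ₚ Q *ₚ (B *ₚ B)
    ≋ (M *ₚ M +ₚ (Q *ₚ (U *ₚ U)) *ₚ (N *ₚ N)) *ₚ (Q *ₚ (M *ₚ M) +ₚ N *ₚ N)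
q-pythagoras {Q} {U} {B} {M} {N} M²≋ = begin
  ((1ₚ +ₚ Q *ₚ U) *ₚ (M *ₚ N)) *ₚ ((1ₚ +ₚ Q *ₚ U) *ₚ (M *ₚ N)) +ₚ Q *ₚ (B *ₚ B)
    ≈⟨ solveₚ 5 (λ Q U B M N →
           ((con 1 :+ Q :* U) :* (M :* N)) :* ((con 1 :+ Q :* U) :* (M :* N)) :+ Q :* (B :* B)
        := (M :* M) :* ((con 1 :+ Q :* U) :* (con 1 :+ Q :* U) :* (N :* N)) :+ Q :* (B :* B)) ≋-refl Q U B M N ⟩
  (M *ₚ M) *ₚ W +ₚ Q *ₚ (B *ₚ B)
    ≈⟨ +ₚ-cong (*ₚ-congˡ W M²≋) ≋-refl ⟩
  (B +ₚ U *ₚ (N *ₚ N)) *ₚ W +ₚ Q *ₚ (B *ₚ B)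
    ≈⟨ solveₚ 4 (λ Q U B N →
           (B :+ U :* (N :* N)) :* ((con 1 :+ Q :* U) :* (con 1 :+ Q :* U) :* (N :* N)) :+ Q :* (B :* B)
        := (B :+ U :* (N :* N) :+ (Q :* (U :* U)) :* (N :* N)) :* (Q :* (B :+ U :* (N :* N)) :+ N :* N))
        ≋-refl Q U B N ⟩
  (B +ₚ U *ₚ (N *ₚ N) +ₚ (Q *ₚ (U *ₚ U)) *ₚ (N *ₚ N)) *ₚ (Q *ₚ (B +ₚ U *ₚ (N *ₚ N)) +ₚ N *ₚ N)
    ≈⟨ *ₚ-cong (+ₚ-cong (≋-sym M²≋) ≋-refl) (+ₚ-cong (*ₚ-congʳ Q (≋-sym M²≋)) ≋-refl) ⟩
  (M *ₚ M +ₚ (Q *ₚ (U *ₚ U)) *ₚ (N *ₚ N)) *ₚ (Q *ₚ (M *ₚ M) +ₚ N *ₚ N) ∎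
  where
  open ≋-Reasoning
  W : Poly
  W = (1ₚ +ₚ Q *ₚ U) *ₚ (1ₚ +ₚ Q *ₚ U) *ₚ (N *ₚ N)

-- q-integers and powers of q

[_]q : ℕ → Poly
[ zero  ]q = []
[ suc n ]q = 1 ∷ [ n ]q

shift : ℕ → Poly → Poly
shift zero    p = p
shift (suc j) p = 0 ∷ shift j p

q^_ : ℕ → Poly
q^ j = shift j 1ₚ

shift-cong : ∀ j {p r} → p ≋ r → shift j p ≋ shift j r
shift-cong zero    eq = eq
shift-cong (suc j) eq = ∷-cong refl (shift-cong j eq)

shift-+ : ∀ i j p → shift (i + j) p ≡ shift i (shift j p)
shift-+ zero    j p = refl
shift-+ (suc i) j p = cong (0 ∷_) (shift-+ i j p)

shift≋q^*ₚ : ∀ j p → shift j p ≋ q^ j *ₚ p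
shift≋q^*ₚ zero    p = ≋-sym (*ₚ-identityˡ p)
shift≋q^*ₚ (suc j) p = ≋-trans (∷-cong refl (shift≋q^*ₚ j p)) (≋-sym (0∷-*ₚ (q^ j) p))

q^-+ : ∀ i j → q^ (i + j) ≋ q^ i *ₚ q^ j
q^-+ i j = ≋-trans (≋-reflexive (shift-+ i j 1ₚ)) (shift≋q^*ₚ i (q^ j))

[]q-+ : ∀ i j → [ i + j ]q ≡ [ i ]q +ₚ shift i [ j ]q
[]q-+ zero    j = refl
[]q-+ (suc i) j = cong (1 ∷_) ([]q-+ i j)

·ₚ-shift : ∀ x j p → x ·ₚ shift j p ≡ shift j (x ·ₚ p)
·ₚ-shift x zero    p = refl
·ₚ-shift x (suc j) p = cong₂ _∷_ (*-zeroʳ x) (·ₚ-shift x j p)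

∷[]-*ₚ : ∀ x p → (x ∷ []) *ₚ p ≋ x ·ₚ p
∷[]-*ₚ x p = ≋-trans (+ₚ-cong ≋-refl (0∷-≋[] ≋-refl)) (≋-reflexive (+ₚ-identityʳ (x ·ₚ p)))

shift-*ₚ : ∀ j p r → shift j p *ₚ r ≋ shift j (p *ₚ r)
shift-*ₚ zero    p r = ≋-refl
shift-*ₚ (suc j) p r = ≋-trans (0∷-*ₚ (shift j p) r) (∷-cong refl (shift-*ₚ j p r))

-- Degree bounds, reflection and palindromic polynomials

record Deg≤ (d : ℕ) (p : Poly) : Set where
  constructor deg≤
  field vanish : ∀ i → d < i → coeff p i ≡ 0
open Deg≤ public

Deg≤-resp-≋ : ∀ {d p r} → p ≋ r → Deg≤ d p → Deg≤ d r
Deg≤-resp-≋ (mk≋ eq) (deg≤ v) = deg≤ λ i d<i → trans (sym (eq i)) (v i d<i)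

Deg≤-mono : ∀ {d e p} → d ≤ e → Deg≤ d p → Deg≤ e p
Deg≤-mono d≤e (deg≤ v) = deg≤ λ i e<i → v i (≤-<-trans d≤e e<i)

Deg≤-+ₚ : ∀ {d p r} → Deg≤ d p → Deg≤ d r → Deg≤ d (p +ₚ r)
Deg≤-+ₚ {p = p} {r} (deg≤ v) (deg≤ w) = deg≤ λ i d<i → trans (coeff-+ₚ p r i) (cong₂ _+_ (v i d<i) (w i d<i))

Deg≤-·ₚ : ∀ {d p} x → Deg≤ d p → Deg≤ d (x ·ₚ p)
Deg≤-·ₚ {p = p} x (deg≤ v) = deg≤ λ i d<i → trans (coeff-·ₚ x p i) (trans (cong (x *_) (v i d<i)) (*-zeroʳ x))

Deg≤-shift : ∀ {d p} j → Deg≤ d p → Deg≤ (j + d) (shift j p)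
Deg≤-shift zero    deg      = deg
Deg≤-shift (suc j) deg = deg≤ λ { (suc i) (s≤s j+d<i) → vanish (Deg≤-shift j deg) i j+d<i }

Deg≤-∷ : ∀ {d x xs} → Deg≤ (suc d) (x ∷ xs) → Deg≤ d xs
Deg≤-∷ (deg≤ v) = deg≤ λ i d<i → v (suc i) (s≤s d<i)

Deg≤-0-∷ : ∀ {x xs} → Deg≤ 0 (x ∷ xs) → xs ≋ []
Deg≤-0-∷ (deg≤ v) = mk≋ λ i → v (suc i) (s≤s z≤n)

Deg≤-*ₚ : ∀ {d e p r} → Deg≤ d p → Deg≤ e r → Deg≤ (d + e) (p *ₚ r)
Deg≤-*ₚ {p = []} _ _ = deg≤ λ _ _ → refl
Deg≤-*ₚ {zero} {p = x ∷ xs} {r} degp degr = Deg≤-+ₚ (Deg≤-·ₚ x degr)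
  (Deg≤-resp-≋ (≋-sym (0∷-≋[] (≋[]⇒*ₚ≋[] r (Deg≤-0-∷ degp)))) (deg≤ λ _ _ → refl))
Deg≤-*ₚ {suc d} {e} {x ∷ xs} degp degr =
  Deg≤-+ₚ (Deg≤-mono (m≤n+m e (suc d)) (Deg≤-·ₚ x degr)) (Deg≤-shift 1 (Deg≤-*ₚ (Deg≤-∷ degp) degr))

-- reflect d p = q^d p(1/q) whenever Deg≤ d p.
reflect : ℕ → Poly → Poly
reflect zero    p = coeff p 0 ∷ []
reflect (suc d) p = coeff p (suc d) ∷ reflect d p

coeff-reflect : ∀ d p {i} → i ≤ d → coeff (reflect d p) i ≡ coeff p (d ∸ i)
coeff-reflect zero    p {zero}  _         = refl
coeff-reflect (suc d) p {zero}  _         = refl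
coeff-reflect (suc d) p {suc i} (s≤s i≤d) = coeff-reflect d p i≤d

Deg≤-reflect : ∀ d p → Deg≤ d (reflect d p)
Deg≤-reflect zero    p = deg≤ λ { (suc i) _ → refl }
Deg≤-reflect (suc d) p = deg≤ λ { (suc i) (s≤s d<i) → vanish (Deg≤-reflect d p) i d<i }

reflect-cong : ∀ d {p r} → p ≋ r → reflect d p ≡ reflect d r
reflect-cong zero    (mk≋ eq) = cong (_∷ []) (eq 0)
reflect-cong (suc d) (mk≋ eq) = cong₂ _∷_ (eq (suc d)) (reflect-cong d (mk≋ eq))

reflect-+ₚ : ∀ d p r → reflect d (p +ₚ r) ≡ reflect d p +ₚ reflect d r
reflect-+ₚ zero    p r = cong (_∷ []) (coeff-+ₚ p r 0)
reflect-+ₚ (suc d) p r = cong₂ _∷_ (coeff-+ₚ p r (suc d)) (reflect-+ₚ d p r)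

reflect-·ₚ : ∀ d x p → reflect d (x ·ₚ p) ≡ x ·ₚ reflect d p
reflect-·ₚ zero    x p = cong (_∷ []) (coeff-·ₚ x p 0)
reflect-·ₚ (suc d) x p = cong₂ _∷_ (coeff-·ₚ x p (suc d)) (reflect-·ₚ d x p)

reflect-[] : ∀ d → reflect d [] ≋ []
reflect-[] zero    = 0∷-≋[] ≋-refl
reflect-[] (suc d) = 0∷-≋[] (reflect-[] d)

reflect-0∷ : ∀ d p → reflect (suc d) (0 ∷ p) ≋ reflect d p
reflect-0∷ zero    p = ∷-cong refl (0∷-≋[] ≋-refl)
reflect-0∷ (suc d) p = ∷-cong refl (reflect-0∷ d p)

reflect-shift : ∀ j d p → reflect (j + d) (shift j p) ≋ reflect d p
reflect-shift zero    d p = ≋-refl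
reflect-shift (suc j) d p = ≋-trans (reflect-0∷ (j + d) (shift j p)) (reflect-shift j d p)

reflect-raise : ∀ j {d p} → Deg≤ d p → reflect (j + d) p ≡ shift j (reflect d p)
reflect-raise zero    {d} deg = refl
reflect-raise (suc j) {d} deg = cong₂ _∷_ (vanish deg (suc (j + d)) (s≤s (m≤n+m d j))) (reflect-raise j deg)

reflect-∷ʳ : ∀ d x xs → reflect (suc d) (x ∷ xs) ≡ reflect d xs ∷ʳ x
reflect-∷ʳ zero    x xs = refl
reflect-∷ʳ (suc d) x xs = cong (coeff xs (suc d) ∷_) (reflect-∷ʳ d x xs)

reflect-∷ : ∀ d x xs → reflect (suc d) (x ∷ xs) ≋ reflect d xs +ₚ shift (suc d) (x ∷ [])
reflect-∷ zero    x xs = ∷-cong (sym (+-identityʳ _)) ≋-refl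
reflect-∷ (suc d) x xs = ∷-cong (sym (+-identityʳ _)) (reflect-∷ d x xs)

reverse≡reflect : ∀ {p} d → length p ≡ suc d → reverse p ≡ reflect d p
reverse≡reflect {x ∷ []}     zero    _   = refl
reverse≡reflect {x ∷ y ∷ ys} (suc d) len = begin
  reverse (x ∷ y ∷ ys)      ≡⟨ unfold-reverse x (y ∷ ys) ⟩
  reverse (y ∷ ys) ∷ʳ x     ≡⟨ cong (_∷ʳ x) (reverse≡reflect d (suc-injective len)) ⟩
  reflect d (y ∷ ys) ∷ʳ x   ≡⟨ reflect-∷ʳ d x (y ∷ ys) ⟨
  reflect (suc d) (x ∷ y ∷ ys) ∎
  where open ≡-Reasoning

reflect-*ₚ : ∀ {d e p r} → Deg≤ d p → Deg≤ e r → reflect (d + e) (p *ₚ r) ≋ reflect d p *ₚ reflect e r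
reflect-*ₚ {d} {e} {[]} {r} _ _ =
  ≋-trans (reflect-[] (d + e)) (≋-sym (≋[]⇒*ₚ≋[] (reflect e r) (reflect-[] d)))
reflect-*ₚ {zero} {e} {x ∷ xs} {r} degp degr = begin
  reflect e (x ·ₚ r +ₚ (0 ∷ xs *ₚ r)) ≡⟨ reflect-cong e (+ₚ-cong ≋-refl (0∷-≋[] (≋[]⇒*ₚ≋[] r (Deg≤-0-∷ degp)))) ⟩
  reflect e (x ·ₚ r +ₚ [])            ≡⟨ cong (reflect e) (+ₚ-identityʳ (x ·ₚ r)) ⟩
  reflect e (x ·ₚ r)                  ≡⟨ reflect-·ₚ e x r ⟩
  x ·ₚ reflect e r                    ≈⟨ ∷[]-*ₚ x (reflect e r) ⟨
  (x ∷ []) *ₚ reflect e r             ∎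
  where open ≋-Reasoning
reflect-*ₚ {suc d} {e} {x ∷ xs} {r} degp degr = begin
  reflect (suc d + e) (x ·ₚ r +ₚ (0 ∷ xs *ₚ r))
    ≡⟨ reflect-+ₚ (suc d + e) (x ·ₚ r) (0 ∷ xs *ₚ r) ⟩
  reflect (suc d + e) (x ·ₚ r) +ₚ reflect (suc d + e) (0 ∷ xs *ₚ r)
    ≡⟨ cong (_+ₚ reflect (suc d + e) (0 ∷ xs *ₚ r))
            (trans (reflect-·ₚ (suc d + e) x r) (cong (x ·ₚ_) (reflect-raise (suc d) degr))) ⟩
  x ·ₚ shift (suc d) (reflect e r) +ₚ reflect (suc d + e) (0 ∷ xs *ₚ r)
    ≈⟨ +ₚ-cong (≋-reflexive (·ₚ-shift x (suc d) (reflect e r))) (reflect-0∷ (d + e) (xs *ₚ r)) ⟩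
  shift (suc d) (x ·ₚ reflect e r) +ₚ reflect (d + e) (xs *ₚ r)
    ≈⟨ +ₚ-cong (shift-cong (suc d) (≋-sym (∷[]-*ₚ x (reflect e r)))) (reflect-*ₚ (Deg≤-∷ degp) degr) ⟩
  shift (suc d) ((x ∷ []) *ₚ reflect e r) +ₚ reflect d xs *ₚ reflect e r
    ≈⟨ +ₚ-cong (≋-sym (shift-*ₚ (suc d) (x ∷ []) (reflect e r))) ≋-refl ⟩
  shift (suc d) (x ∷ []) *ₚ reflect e r +ₚ reflect d xs *ₚ reflect e r
    ≈⟨ *ₚ-distribʳ-+ₚ (reflect e r) (shift (suc d) (x ∷ [])) (reflect d xs) ⟨
  (shift (suc d) (x ∷ []) +ₚ reflect d xs) *ₚ reflect e r
    ≡⟨ cong (_*ₚ reflect e r) (+ₚ-comm (shift (suc d) (x ∷ [])) (reflect d xs)) ⟩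
  (reflect d xs +ₚ shift (suc d) (x ∷ [])) *ₚ reflect e r
    ≈⟨ *ₚ-congˡ (reflect e r) (reflect-∷ d x xs) ⟨
  reflect (suc d) (x ∷ xs) *ₚ reflect e r ∎
  where open ≋-Reasoning

Palindromic : ℕ → Poly → Set
Palindromic d p = Deg≤ d p × reflect d p ≋ p

palindromic-*ₚ : ∀ {d e p r} → Palindromic d p → Palindromic e r → Palindromic (d + e) (p *ₚ r)
palindromic-*ₚ (degp , refl-p) (degr , refl-r) =
  Deg≤-*ₚ degp degr , ≋-trans (reflect-*ₚ degp degr) (*ₚ-cong refl-p refl-r)

palindromic-+ₚshift : ∀ {d p} j → Palindromic d p → Palindromic (j + d) (p +ₚ shift j p)
palindromic-+ₚshift {d} {p} j (deg , refl-p) =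
  Deg≤-+ₚ (Deg≤-mono (m≤n+m d j) deg) (Deg≤-shift j deg) , (begin
    reflect (j + d) (p +ₚ shift j p)                   ≡⟨ reflect-+ₚ (j + d) p (shift j p) ⟩
    reflect (j + d) p +ₚ reflect (j + d) (shift j p)   ≈⟨ +ₚ-cong (≋-reflexive (reflect-raise j deg)) (reflect-shift j d p) ⟩
    shift j (reflect d p) +ₚ reflect d p               ≈⟨ +ₚ-cong (shift-cong j refl-p) refl-p ⟩
    shift j p +ₚ p                                     ≡⟨ +ₚ-comm (shift j p) p ⟩
    p +ₚ shift j p                                     ∎)
  where open ≋-Reasoning

coeff-[]q : ∀ n {i} → n ≤ i → coeff [ n ]q i ≡ 0
coeff-[]q zero    _         = refl
coeff-[]q (suc n) (s≤s n≤i) = coeff-[]q n n≤i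

coeff-[]q-< : ∀ n {i} → i < n → coeff [ n ]q i ≡ 1
coeff-[]q-< (suc n) {zero}  _         = refl
coeff-[]q-< (suc n) {suc i} (s≤s i<n) = coeff-[]q-< n i<n

palindromic-[]q : ∀ n → Palindromic n [ suc n ]q
palindromic-[]q n = deg≤ (λ i → coeff-[]q (suc n)) , mk≋ reflected
  where
  reflected : ∀ i → coeff (reflect n [ suc n ]q) i ≡ coeff [ suc n ]q i
  reflected i with i ≤? n
  ... | yes i≤n = trans (coeff-reflect n [ suc n ]q i≤n)
                    (trans (coeff-[]q-< (suc n) (s≤s (m∸n≤m n i))) (sym (coeff-[]q-< (suc n) (s≤s i≤n))))
  ... | no  i≰n = trans (vanish (Deg≤-reflect n [ suc n ]q) i (≰⇒> i≰n)) (sym (coeff-[]q (suc n) (≰⇒> i≰n)))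

palindromic-coeff : ∀ {d p} → Palindromic d p → coeff p d ≡ coeff p 0
palindromic-coeff {d} {p} (_ , refl-p) = trans (sym (coeff-reflect d p z≤n)) (coeff-≡ refl-p 0)

positive-+ₚ : ∀ {p r} → PositiveCoeffs p → PositiveCoeffs r → PositiveCoeffs (p +ₚ r)
positive-+ₚ {[]}    {_}     _          posr       = posr
positive-+ₚ {_ ∷ _} {[]}    posp       _          = posp
positive-+ₚ {x ∷ _} {y ∷ _} (x≥1 ∷ posp) (_ ∷ posr) = ≤-trans x≥1 (m≤m+n x y) ∷ positive-+ₚ posp posr

positive-·ₚ : ∀ {x p} → 1 ≤ x → PositiveCoeffs p → PositiveCoeffs (x ·ₚ p)
positive-·ₚ x≥1 []           = []
positive-·ₚ x≥1 (y≥1 ∷ posp) = *-mono-≤ x≥1 y≥1 ∷ positive-·ₚ x≥1 posp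

positive-*ₚ : ∀ {p y ys} → PositiveCoeffs p → PositiveCoeffs (y ∷ ys) → PositiveCoeffs (p *ₚ (y ∷ ys))
positive-*ₚ {[]}             _            _               = []
positive-*ₚ {x ∷ xs} {y} {ys} (x≥1 ∷ posp) (y≥1 ∷ posys) =
  ≤-trans (*-mono-≤ x≥1 y≥1) (m≤m+n (x * y) 0)
    ∷ positive-+ₚ (positive-·ₚ x≥1 posys) (positive-*ₚ posp (y≥1 ∷ posys))

positive-[]q : ∀ n → PositiveCoeffs [ n ]q
positive-[]q zero    = []
positive-[]q (suc n) = ≤-refl ∷ positive-[]q n

positive-+ₚshift : ∀ {p r} j → j ≤ length p → PositiveCoeffs p → PositiveCoeffs r → PositiveCoeffs (p +ₚ shift j r)
positive-+ₚshift zero    _         posp posr = positive-+ₚ posp posr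
positive-+ₚshift {x ∷ _} (suc j) (s≤s j≤len) (x≥1 ∷ posp) posr =
  ≤-trans x≥1 (m≤m+n x 0) ∷ positive-+ₚshift j j≤len posp posr

length-exact : ∀ {p} d → PositiveCoeffs p → Deg≤ d p → coeff p d ≢ 0 → length p ≡ suc d
length-exact {[]}         d       _               _   p[d]≢0 = contradiction refl p[d]≢0
length-exact {_ ∷ []}     zero    _               _   _      = refl
length-exact {_ ∷ _ ∷ _}  zero    (_ ∷ y≥1 ∷ _)   deg _      = contradiction (vanish deg 1 (s≤s z≤n)) (n>0⇒n≢0 y≥1)
length-exact {_ ∷ _}      (suc d) (_ ∷ pos)       deg p[d]≢0 = cong suc (length-exact d pos (Deg≤-∷ deg) p[d]≢0)

palindromic-length : ∀ {d p} → Palindromic d p → PositiveCoeffs p → coeff p 0 ≡ 1 → length p ≡ suc d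
palindromic-length {d} pal pos p[0]≡1 =
  length-exact d pos (proj₁ pal) λ p[d]≡0 → 1+n≢0 (trans (sym (trans (palindromic-coeff pal) p[0]≡1)) p[d]≡0)

leadingCoeff-length : ∀ p {d} → length p ≡ suc d → leadingCoeff p ≡ coeff p d
leadingCoeff-length p len = cong (λ l → coeff p (l ∸ 1)) len

palindromic-selfReciprocal : ∀ {d p} → Palindromic d p → length p ≡ suc d → SelfReciprocal p
palindromic-selfReciprocal {d} {p} (_ , refl-p) len i =
  trans (cong (λ r → coeff r i) (reverse≡reflect d len)) (coeff-≡ refl-p i)

palindromic-monic : ∀ {d p} → Palindromic d p → length p ≡ suc d → coeff p 0 ≡ 1 → Monic p
palindromic-monic {p = p} pal len p[0]≡1 = trans (leadingCoeff-length p len) (trans (palindromic-coeff pal) p[0]≡1) , p[0]≡1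

monic-reverse : ∀ p {d} → length p ≡ suc d → Monic p → Monic (reverse p)
monic-reverse p {d} len (leading , lowest) = leading′ , trans lowest′ (trans (sym (leadingCoeff-length p len)) leading)
  where
  rev≡ : reverse p ≡ reflect d p
  rev≡ = reverse≡reflect d len
  lowest′ : lowestCoeff (reverse p) ≡ coeff p d
  lowest′ = trans (cong (λ r → coeff r 0) rev≡) (coeff-reflect d p z≤n)
  leading′ : leadingCoeff (reverse p) ≡ 1
  leading′ = begin
    leadingCoeff (reverse p) ≡⟨ leadingCoeff-length (reverse p) (trans (length-reverse p) len) ⟩
    coeff (reverse p) d      ≡⟨ cong (λ r → coeff r d) rev≡ ⟩
    coeff (reflect d p) d    ≡⟨ coeff-reflect d p ≤-refl ⟩
    coeff p (d ∸ d)          ≡⟨ cong (coeff p) (n∸n≡0 d) ⟩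
    coeff p 0                ≡⟨ lowest ⟩
    1                        ∎
    where open ≡-Reasoning

eval1-+ₚ : ∀ p r → eval1 (p +ₚ r) ≡ eval1 p + eval1 r
eval1-+ₚ []       r        = refl
eval1-+ₚ (x ∷ xs) []       = sym (+-identityʳ _)
eval1-+ₚ (x ∷ xs) (y ∷ ys) = trans (cong (x + y +_) (eval1-+ₚ xs ys)) (+-interchange x y (sum xs) (sum ys))

eval1-·ₚ : ∀ x p → eval1 (x ·ₚ p) ≡ x * eval1 p
eval1-·ₚ x []       = sym (*-zeroʳ x)
eval1-·ₚ x (y ∷ ys) = trans (cong (x * y +_) (eval1-·ₚ x ys)) (sym (*-distribˡ-+ x y (sum ys)))

eval1-*ₚ : ∀ p r → eval1 (p *ₚ r) ≡ eval1 p * eval1 r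
eval1-*ₚ []       r = refl
eval1-*ₚ (x ∷ xs) r = begin
  eval1 (x ·ₚ r +ₚ (0 ∷ xs *ₚ r))  ≡⟨ eval1-+ₚ (x ·ₚ r) (0 ∷ xs *ₚ r) ⟩
  eval1 (x ·ₚ r) + eval1 (xs *ₚ r) ≡⟨ cong₂ _+_ (eval1-·ₚ x r) (eval1-*ₚ xs r) ⟩
  x * sum r + sum xs * sum r       ≡⟨ *-distribʳ-+ (sum r) x (sum xs) ⟨
  (x + sum xs) * sum r             ∎
  where open ≡-Reasoning

eval1-shift : ∀ j p → eval1 (shift j p) ≡ eval1 p
eval1-shift zero    p = refl
eval1-shift (suc j) p = eval1-shift j p

eval1-[]q : ∀ n → eval1 [ n ]q ≡ n
eval1-[]q zero    = refl
eval1-[]q (suc n) = cong suc (eval1-[]q n)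

eval1-[]q*ₚ[]q : ∀ i j → eval1 ([ i ]q *ₚ [ j ]q) ≡ i * j
eval1-[]q*ₚ[]q i j = trans (eval1-*ₚ [ i ]q [ j ]q) (cong₂ _*_ (eval1-[]q i) (eval1-[]q j))

-- Euclid's parametrisation of standard triples

square-injective : ∀ {m n} → m * m ≡ n * n → m ≡ n
square-injective m²≡n² = ≤-antisym
  (≮⇒≥ λ n<m → >⇒≢ (*-mono-< n<m n<m) m²≡n²)
  (≮⇒≥ λ m<n → <⇒≢ (*-mono-< m<n m<n) m²≡n²)

square-<⇒< : ∀ {m n} → m * m < n * n → m < n
square-<⇒< m²<n² = ≰⇒> λ n≤m → ≤⇒≯ (*-mono-≤ n≤m n≤m) m²<n²

coprime-product-square : ∀ {X Y Z} → Coprime X Y → X * Y ≡ Z * Z → ∃ λ m → m * m ≡ X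
coprime-product-square {zero}           _   _      = 0 , refl
coprime-product-square {X@(suc _)} {Y} {Z} X⊥Y XY≡ZZ = g , ∣-antisym gg∣X X∣gg
  where
  g : ℕ
  g = gcd X Z
  instance
    g≢0 : NonZero g
    g≢0 = ≢-nonZero (gcd[m,n]≢0 X Z (inj₁ λ ()))
  X∣c*g : ∀ c → X ∣ c * Z → X ∣ c * g
  X∣c*g c X∣cZ = subst (X ∣_) (sym (c*gcd[m,n]≡gcd[cm,cn] c X Z)) (gcd-greatest (n∣m*n c) X∣cZ)
  X∣Z*g : X ∣ Z * g
  X∣Z*g = X∣c*g Z (subst (X ∣_) XY≡ZZ (m∣m*n Y))
  X∣gg : X ∣ g * g
  X∣gg = X∣c*g g (subst (X ∣_) (*-comm Z g) X∣Z*g)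
  g∣X : g ∣ X
  g∣X = gcd[m,n]∣m X Z
  x : ℕ
  x = quotient g∣X
  X≡gx : X ≡ g * x
  X≡gx = m∣n⇒n≡m*quotient g∣X
  -- g² ∣ Z² = X Y = g x Y, and g is coprime to Y since it divides X.
  g∣Yx : g ∣ Y * x
  g∣Yx = subst (g ∣_) (*-comm x Y) (*-cancelˡ-∣ g (subst (g * g ∣_)
    (trans (sym XY≡ZZ) (trans (cong (_* Y) X≡gx) (*-assoc g x Y))) (*-pres-∣ (gcd[m,n]∣n X Z) (gcd[m,n]∣n X Z))))
  gg∣X : g * g ∣ X
  gg∣X = subst (g * g ∣_) (sym X≡gx)
    (*-monoʳ-∣ g (coprime-divisor (λ (d∣g , d∣Y) → X⊥Y (∣-trans d∣g g∣X , d∣Y)) g∣Yx))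

halve-standard : ∀ {a b c} → (gcd (gcd a b) c ≡ 1 × Even a) ⊎ (gcd (gcd a b) c ≡ 2 × Odd (a / 2)) →
  ∃ λ Z → a ≡ Z * 2 × Coprime (gcd (gcd a b) c) Z
halve-standard (inj₁ (g≡1 , divides Z a≡Z*2)) = Z , a≡Z*2 , subst (λ g → Coprime g Z) (sym g≡1) (1-coprimeTo Z)
halve-standard {a} {b} {c} (inj₂ (g≡2 , a/2-odd))
  with subst (_∣ a) g≡2 (∣-trans (gcd[m,n]∣m (gcd a b) c) (gcd[m,n]∣m a b))
... | divides Z a≡Z*2 = Z , a≡Z*2 , subst (λ g → Coprime g Z) (sym g≡2) 2⊥Z
  where
  Z-odd : Odd Z
  Z-odd = subst Odd (trans (cong (_/ 2) a≡Z*2) (m*n/n≡m Z 2)) a/2-odd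
  2⊥Z : Coprime 2 Z
  2⊥Z (d∣2 , d∣Z) = [ id , (λ d≡2 → contradiction (subst (_∣ Z) d≡2 d∣Z) Z-odd) ]′ (irreducible[2] d∣2)

pythagorean-difference : ∀ {a b c} → a * a + b * b ≡ c * c → ∃ λ t → c ≡ b + t × b * t * 2 + t * t ≡ a * a
pythagorean-difference {a} {b} {c} pyth with m≤n⇒∃[o]m+o≡n b≤c
  where
  b≤c : b ≤ c
  b≤c = ≮⇒≥ λ c<b → <⇒≱ (*-mono-< c<b c<b) (subst (b * b ≤_) pyth (m≤n+m (b * b) (a * a)))
... | t , refl = t , refl , +-cancelʳ-≡ (b * b) _ _ (begin
  b * t * 2 + t * t + b * b ≡⟨ square-of-sum b t ⟩
  (b + t) * (b + t)         ≡⟨ pyth ⟨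
  a * a + b * b             ∎)
  where
  open ≡-Reasoning
  square-of-sum : ∀ b t → b * t * 2 + t * t + b * b ≡ (b + t) * (b + t)
  square-of-sum = solve-∀

2∣square⇒2∣ : ∀ t → 2 ∣ t * t → 2 ∣ t
2∣square⇒2∣ t 2∣t² = [ id , id ]′ (euclidsLemma t t prime[2] 2∣t²)

pythagorean-halves : ∀ {a b c Z} → a ≡ Z * 2 → a * a + b * b ≡ c * c →
  ∃ λ Y → c ≡ b + Y * 2 × (b + Y) * Y ≡ Z * Z
pythagorean-halves {a} {b} {c} {Z} refl pyth with pythagorean-difference {Z * 2} {b} {c} pyth
... | t , refl , 2bt+t²≡a²
  with 2∣square⇒2∣ t (∣m+n∣m⇒∣n (subst (2 ∣_) (sym 2bt+t²≡a²) (n∣m*n*o Z (Z * 2))) (n∣m*n (b * t)))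
... | divides Y refl = Y , refl , *-cancelˡ-≡ _ _ 4 (begin
  4 * ((b + Y) * Y)                 ≡⟨ expand-left b Y ⟩
  b * (Y * 2) * 2 + Y * 2 * (Y * 2) ≡⟨ 2bt+t²≡a² ⟩
  Z * 2 * (Z * 2)                   ≡⟨ expand-right Z ⟩
  4 * (Z * Z)                       ∎)
  where
  open ≡-Reasoning
  expand-left : ∀ b Y → 4 * ((b + Y) * Y) ≡ b * (Y * 2) * 2 + Y * 2 * (Y * 2)
  expand-left = solve-∀
  expand-right : ∀ Z → Z * 2 * (Z * 2) ≡ 4 * (Z * Z)
  expand-right = solve-∀

-- A common divisor of b + Y and Y divides b and c, so by hypothesis it is coprime to Z;
-- as it divides Z², it divides Z, hence a.
halves-coprime : ∀ {a b c Z Y} → Coprime (gcd (gcd a b) c) Z → a ≡ Z * 2 → c ≡ b + Y * 2 →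
  (b + Y) * Y ≡ Z * Z → Coprime (b + Y) Y
halves-coprime {b = b} {Z = Z} {Y} g⊥Z refl refl XY≡ZZ {d} (d∣X , d∣Y) = common d∣X d∣Y d∣Z
  where
  common : ∀ {e} → e ∣ b + Y → e ∣ Y → e ∣ Z → e ≡ 1
  common {e} e∣X e∣Y e∣Z =
    g⊥Z (gcd-greatest (gcd-greatest (∣m⇒∣m*n 2 e∣Z) e∣b) (∣m∣n⇒∣m+n e∣b (∣m⇒∣m*n 2 e∣Y)) , e∣Z)
    where
    e∣b : e ∣ b
    e∣b = ∣m+n∣m⇒∣n (subst (e ∣_) (+-comm b Y) e∣X) e∣Y
  d∣Z : d ∣ Z
  d∣Z = coprime-divisor (λ (e∣d , e∣Z) → common (∣-trans e∣d d∣X) (∣-trans e∣d d∣Y) e∣Z)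
    (subst (d ∣_) XY≡ZZ (∣m⇒∣m*n Y d∣X))

EuclidTriple : ℕ → ℕ → ℕ → ℕ → ℕ → Set
EuclidTriple n k a b c = a ≡ (n + k) * n + (n + k) * n × b ≡ k * (n + k + n) × c ≡ (n + k) * (n + k) + n * n

euclidTriple-from-roots : ∀ {a b c Z Y} n k → a ≡ Z * 2 → c ≡ b + Y * 2 →
  (n + k) * (n + k) ≡ b + Y → n * n ≡ Y → (n + k) * n ≡ Z → EuclidTriple n k a b c
euclidTriple-from-roots {b = b} n k refl refl m²≡X refl refl =
  twice ((n + k) * n) ,
  +-cancelʳ-≡ (n * n) _ _ (trans (sym m²≡X) (difference-of-squares n k)) ,
  trans (twice-+ b (n * n)) (cong (_+ n * n) (sym m²≡X))
  where
  twice : ∀ x → x * 2 ≡ x + x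
  twice = solve-∀
  twice-+ : ∀ b x → b + x * 2 ≡ b + x + x
  twice-+ = solve-∀
  difference-of-squares : ∀ n k → (n + k) * (n + k) ≡ k * (n + k + n) + n * n
  difference-of-squares = solve-∀

m<n⇒∃[o]m+suc[o]≡n : ∀ {m n} → m < n → ∃ λ o → m + suc o ≡ n
m<n⇒∃[o]m+suc[o]≡n {m} m<n with o , 1+m+o≡n ← m≤n⇒∃[o]m+o≡n m<n = o , trans (+-suc m o) 1+m+o≡n

roots⇒euclidTriple : ∀ {a b c Z Y} m n → 1 ≤ a → 1 ≤ b → a ≡ Z * 2 → c ≡ b + Y * 2 → (b + Y) * Y ≡ Z * Z →
  m * m ≡ b + Y → n * n ≡ Y → ∃₂ λ n′ k′ → EuclidTriple (suc n′) (suc k′) a b c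
roots⇒euclidTriple {b = b} {Z = Z} m zero a≥1 _ refl _ XY≡ZZ _ refl =
  contradiction (cong (_* 2) Z≡0) (n>0⇒n≢0 a≥1)
  where
  Z≡0 : Z ≡ 0
  Z≡0 = [ id , id ]′ (m*n≡0⇒m≡0∨n≡0 Z (trans (sym XY≡ZZ) (*-zeroʳ (b + 0))))
roots⇒euclidTriple {b = b} {Z = Z} {Y} m n@(suc n′) _ b≥1 a≡Z*2 c≡b+2Y XY≡ZZ m²≡X n²≡Y
  with k′ , refl ← m<n⇒∃[o]m+suc[o]≡n (square-<⇒< {n} {m} (subst₂ _<_ (sym n²≡Y) (sym m²≡X) (m<n+m Y b≥1))) =
  n′ , k′ , euclidTriple-from-roots n (suc k′) a≡Z*2 c≡b+2Y m²≡X n²≡Y (square-injective {m * n} {Z} (begin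
    m * n * (m * n)   ≡⟨ [m*n]*[o*p]≡[m*o]*[n*p] m n m n ⟩
    m * m * (n * n)   ≡⟨ cong₂ _*_ m²≡X n²≡Y ⟩
    (b + Y) * Y       ≡⟨ XY≡ZZ ⟩
    Z * Z             ∎))
  where open ≡-Reasoning

standard⇒euclidTriple : ∀ {a b c} → Standard a b c → ∃₂ λ n′ k′ → EuclidTriple (suc n′) (suc k′) a b c
standard⇒euclidTriple {a} {b} {c} ((a≥1 , b≥1 , _ , pyth) , std)
  with Z , a≡Z*2 , g⊥Z ← halve-standard std
  with Y , c≡b+2Y , XY≡ZZ ← pythagorean-halves {Z = Z} a≡Z*2 pyth
  with X⊥Y ← halves-coprime {Z = Z} {Y} g⊥Z a≡Z*2 c≡b+2Y XY≡ZZ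
  with m , m²≡X ← coprime-product-square {Z = Z} X⊥Y XY≡ZZ
  with n , n²≡Y ← coprime-product-square {Z = Z} (coprime-sym X⊥Y) (trans (*-comm Y (b + Y)) XY≡ZZ)
  = roots⇒euclidTriple {Z = Z} {Y} m n a≥1 b≥1 a≡Z*2 c≡b+2Y XY≡ZZ m²≡X n²≡Y

-- The q-deformed triple

module QDeformedTriple (n′ k′ : ℕ) where

  n k m : ℕ
  n = suc n′
  k = suc k′
  m = n + k

  M N K T : Poly
  M = [ m ]q
  N = [ n ]q
  K = [ k ]q
  T = M *ₚ N

  A B C C* : Poly
  A = T +ₚ shift (suc k) T
  B = K *ₚ [ m + n ]q
  C = M *ₚ M +ₚ shift (suc (k + k)) (N *ₚ N)
  C* = qₚ* (M *ₚ M) +ₚ N *ₚ N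

  M²≋B+q^kN² : M *ₚ M ≋ B +ₚ q^ k *ₚ (N *ₚ N)
  M²≋B+q^kN² = begin
    M *ₚ M
      ≈⟨ *ₚ-cong M≋K+UN M≋N+VK ⟩
    (K +ₚ U *ₚ N) *ₚ (N +ₚ V *ₚ K)
      ≈⟨ solveₚ 4 (λ K N U V → (K :+ U :* N) :* (N :+ V :* K)
                              := K :* ((N :+ V :* K) :+ (V :* U) :* N) :+ U :* (N :* N)) ≋-refl K N U V ⟩
    K *ₚ ((N +ₚ V *ₚ K) +ₚ (V *ₚ U) *ₚ N) +ₚ U *ₚ (N *ₚ N)
      ≈⟨ +ₚ-congˡ (U *ₚ (N *ₚ N)) (*ₚ-congʳ K (≋-sym [m+n]≋)) ⟩
    B +ₚ U *ₚ (N *ₚ N) ∎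
    where
    open ≋-Reasoning
    U V : Poly
    U = q^ k
    V = q^ n
    M≋K+UN : M ≋ K +ₚ U *ₚ N
    M≋K+UN = ≋-trans (≋-reflexive (trans (cong [_]q (+-comm n k)) ([]q-+ k n))) (+ₚ-congʳ K (shift≋q^*ₚ k N))
    M≋N+VK : M ≋ N +ₚ V *ₚ K
    M≋N+VK = ≋-trans (≋-reflexive ([]q-+ n k)) (+ₚ-congʳ N (shift≋q^*ₚ n K))
    [m+n]≋ : [ m + n ]q ≋ (N +ₚ V *ₚ K) +ₚ (V *ₚ U) *ₚ N
    [m+n]≋ = ≋-trans (≋-reflexive ([]q-+ m n)) (+ₚ-cong M≋N+VK (≋-trans (shift≋q^*ₚ m N) (*ₚ-congˡ N (q^-+ n k))))

  palindromic-M : Palindromic (n′ + k) M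
  palindromic-M = palindromic-[]q (n′ + k)

  palindromic-N : Palindromic n′ N
  palindromic-N = palindromic-[]q n′

  palindromic-T : Palindromic (n′ + k + n′) T
  palindromic-T = palindromic-*ₚ palindromic-M palindromic-N

  palindromic-A : Palindromic (suc k + (n′ + k + n′)) A
  palindromic-A = palindromic-+ₚshift (suc k) palindromic-T

  palindromic-B : Palindromic (k′ + (n′ + k + n)) B
  palindromic-B = palindromic-*ₚ (palindromic-[]q k′) (palindromic-[]q (n′ + k + n))

  palindromic-M² : Palindromic (n′ + k + (n′ + k)) (M *ₚ M)
  palindromic-M² = palindromic-*ₚ palindromic-M palindromic-M

  palindromic-N² : Palindromic (n′ + n′) (N *ₚ N)
  palindromic-N² = palindromic-*ₚ palindromic-N palindromic-N

  positive-T : PositiveCoeffs T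
  positive-T = positive-*ₚ (positive-[]q m) (positive-[]q n)

  positive-A : PositiveCoeffs A
  positive-A = positive-+ₚshift (suc k) k<length-T positive-T positive-T
    where
    k<length-T : suc k ≤ length T
    k<length-T = subst (suc k ≤_) (sym (palindromic-length palindromic-T positive-T refl))
      (s≤s (≤-trans (m≤n+m k n′) (m≤m+n (n′ + k) n′)))

  positive-B : PositiveCoeffs B
  positive-B = positive-*ₚ (positive-[]q k) (positive-[]q (m + n))

  positive-C : PositiveCoeffs C
  positive-C = positive-+ₚshift (suc (k + k)) 2k<length-M² positive-M² (positive-*ₚ (positive-[]q n) (positive-[]q n))
    where
    positive-M² : PositiveCoeffs (M *ₚ M)
    positive-M² = positive-*ₚ (positive-[]q m) (positive-[]q m)
    2k<length-M² : suc (k + k) ≤ length (M *ₚ M)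
    2k<length-M² = subst (suc (k + k) ≤_) (sym (palindromic-length palindromic-M² positive-M² refl))
      (s≤s (+-mono-≤ (m≤n+m k n′) (m≤n+m k n′)))

  dC : ℕ
  dC = suc (k + k) + (n′ + n′)

  dC≡1+deg-M² : dC ≡ 1 + (n′ + k + (n′ + k))
  dC≡1+deg-M² = shuffle n′ k
    where
    shuffle : ∀ a b → suc (b + b) + (a + a) ≡ 1 + (a + b + (a + b))
    shuffle = solve-∀

  reflect-C : reflect dC C ≋ C*
  reflect-C = begin
    reflect dC C
      ≡⟨ reflect-+ₚ dC (M *ₚ M) (shift (suc (k + k)) (N *ₚ N)) ⟩
    reflect dC (M *ₚ M) +ₚ reflect dC (shift (suc (k + k)) (N *ₚ N))
      ≡⟨ cong (_+ₚ reflect dC (shift (suc (k + k)) (N *ₚ N))) reflect-M² ⟩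
    qₚ* (reflect (n′ + k + (n′ + k)) (M *ₚ M)) +ₚ reflect dC (shift (suc (k + k)) (N *ₚ N))
      ≈⟨ +ₚ-cong (∷-cong refl (proj₂ palindromic-M²))
                 (≋-trans (reflect-shift (suc (k + k)) (n′ + n′) (N *ₚ N)) (proj₂ palindromic-N²)) ⟩
    C* ∎
    where
    open ≋-Reasoning
    reflect-M² : reflect dC (M *ₚ M) ≡ qₚ* (reflect (n′ + k + (n′ + k)) (M *ₚ M))
    reflect-M² = trans (cong (λ d → reflect d (M *ₚ M)) dC≡1+deg-M²) (reflect-raise 1 (proj₁ palindromic-M²))

  degree-C : Deg≤ dC C
  degree-C = Deg≤-+ₚ
    (Deg≤-mono (≤-trans (n≤1+n _) (≤-reflexive (sym dC≡1+deg-M²))) (proj₁ palindromic-M²))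
    (Deg≤-shift (suc (k + k)) (proj₁ palindromic-N²))

  leading-C : coeff C dC ≡ 1
  leading-C = trans (sym (coeff-reflect dC C z≤n)) (coeff-≡ reflect-C 0)

  length-C : length C ≡ suc dC
  length-C = length-exact dC positive-C degree-C λ C[dC]≡0 → 1+n≢0 (trans (sym leading-C) C[dC]≡0)

  monic-C : Monic C
  monic-C = trans (leadingCoeff-length C length-C) leading-C , refl

  q-pythagoras-ABC : A *ₚ A +ₚ qₚ* (B *ₚ B) ≋ C *ₚ reverse C
  q-pythagoras-ABC = begin
    A *ₚ A +ₚ qₚ* (B *ₚ B)
      ≈⟨ +ₚ-cong (*ₚ-cong A≋ A≋) (shift≋q^*ₚ 1 (B *ₚ B)) ⟩
    ((1ₚ +ₚ Q *ₚ U) *ₚ T) *ₚ ((1ₚ +ₚ Q *ₚ U) *ₚ T) +ₚ Q *ₚ (B *ₚ B)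
      ≈⟨ q-pythagoras {Q} {U} {B} {M} {N} M²≋B+q^kN² ⟩
    (M *ₚ M +ₚ (Q *ₚ (U *ₚ U)) *ₚ (N *ₚ N)) *ₚ (Q *ₚ (M *ₚ M) +ₚ N *ₚ N)
      ≈⟨ *ₚ-cong (≋-sym C≋) (≋-sym (≋-trans reflect-C (+ₚ-congˡ (N *ₚ N) (shift≋q^*ₚ 1 (M *ₚ M))))) ⟩
    C *ₚ reflect dC C
      ≡⟨ cong (C *ₚ_) (reverse≡reflect dC length-C) ⟨
    C *ₚ reverse C ∎
    where
    open ≋-Reasoning
    Q U : Poly
    Q = q^ 1
    U = q^ k
    A≋ : A ≋ (1ₚ +ₚ Q *ₚ U) *ₚ T
    A≋ = ≋-trans (+ₚ-congʳ T (≋-trans (shift≋q^*ₚ (suc k) T) (*ₚ-congˡ T (q^-+ 1 k))))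
      (≋-sym (≋-trans (*ₚ-distribʳ-+ₚ T 1ₚ (Q *ₚ U)) (+ₚ-congˡ ((Q *ₚ U) *ₚ T) (*ₚ-identityˡ T))))
    C≋ : C ≋ M *ₚ M +ₚ (Q *ₚ (U *ₚ U)) *ₚ (N *ₚ N)
    C≋ = +ₚ-congʳ (M *ₚ M) (≋-trans (shift≋q^*ₚ (suc (k + k)) (N *ₚ N))
      (*ₚ-congˡ (N *ₚ N) (≋-trans (q^-+ 1 (k + k)) (*ₚ-congʳ Q (q^-+ k k)))))

  length-A : length A ≡ suc (suc k + (n′ + k + n′))
  length-A = palindromic-length palindromic-A positive-A refl

  length-B : length B ≡ suc (k′ + (n′ + k + n))
  length-B = palindromic-length palindromic-B positive-B refl

  eval1-A : eval1 A ≡ m * n + m * n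
  eval1-A = trans (eval1-+ₚ T (shift (suc k) T))
    (cong₂ _+_ (eval1-[]q*ₚ[]q m n) (trans (eval1-shift (suc k) T) (eval1-[]q*ₚ[]q m n)))

  eval1-B : eval1 B ≡ k * (m + n)
  eval1-B = eval1-[]q*ₚ[]q k (m + n)

  eval1-C : eval1 C ≡ m * m + n * n
  eval1-C = trans (eval1-+ₚ (M *ₚ M) (shift (suc (k + k)) (N *ₚ N)))
    (cong₂ _+_ (eval1-[]q*ₚ[]q m m) (trans (eval1-shift (suc (k + k)) (N *ₚ N)) (eval1-[]q*ₚ[]q n n)))

theorem1 : (a b c : ℕ) → Standard a b c →
    Σ Poly λ A → Σ Poly λ B → Σ Poly λ C →
    ((A *ₚ A) +ₚ qₚ* (B *ₚ B) ≈ₚ C *ₚ reciprocal C)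
    × (PositiveCoeffs A × PositiveCoeffs B × PositiveCoeffs C)
    × (SelfReciprocal A × SelfReciprocal B)
    × (Monic A × Monic B × Monic C × Monic (reciprocal C))
    × (eval1 A ≡ a × eval1 B ≡ b × eval1 C ≡ c)
theorem1 a b c std with n′ , k′ , a≡ , b≡ , c≡ ← standard⇒euclidTriple std =
  A , B , C ,
  coeff-≡ q-pythagoras-ABC ,
  (positive-A , positive-B , positive-C) ,
  (palindromic-selfReciprocal palindromic-A length-A , palindromic-selfReciprocal palindromic-B length-B) ,
  (palindromic-monic palindromic-A length-A refl , palindromic-monic palindromic-B length-B refl ,
   monic-C , monic-reverse C length-C monic-C) ,
  (trans eval1-A (sym a≡) , trans eval1-B (sym b≡) , trans eval1-C (sym c≡))
  where open QDeformedTriple n′ k′
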